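{- Let $e$ be a regular expression over a finite alphabet $\Sigma$, let $\pi$ be a heap and $p$ an address such that $\pi,p\models e$, and let $\mathrm{cont}$ be the continuation function with $\pi\models\mathrm{cont}$ (with $p$ as root). Then for every string $w\in\Sigma^*$, there is a run of the EKW machine \[ \langle e\,;\,[\,]\,;\,w\rangle \to^{*} \langle \varepsilon\,;\,[\,]\,;\,\epsilon_{\mathrm{str}}\rangle \] if and only if there is a run of the PW$\pi$ machine (relative to $\pi$ and $\mathrm{cont}$) \[ \langle p\,;\,w\rangle \to^{*} \langle \mathrm{null}\,;\,\epsilon_{\mathrm{str}}\rangle . \]
   Context: Regular expressions over $\Sigma$: $e ::= \varepsilon \mid a \mid e^{*} \mid e_1e_2 \mid e_1\mid e_2$ ($a\in\Sigma$); $\varepsilon$ is a constant and $\epsilon_{\mathrm{str}}$ denotes the empty string. Lists: $h::t$ is cons, $[\,]$ the empty list. $\to^*$ denotes zero or more transitions. EKW machine: configurations $\langle e;k;w\rangle$ ($e$ a regular expression, $k$ a list of regular expressions, $w$ a string), with transitions exactly: $\langle e_1\mid e_2;k;w\rangle\to\langle e_1;k;w\rangle$; $\langle e_1\mid e_2;k;w\rangle\to\langle e_2;k;w\rangle$; $\langle e_1e_2;k;w\rangle\to\langle e_1;e_2::k;w\rangle$; $\langle e^{*};k;w\rangle\to\langle e;e^{*}::k;w\rangle$; $\langle e^{*};k;w\rangle\to\langle \varepsilon;k;w\rangle$; $\langle a;k;a\,w\rangle\to\langle\varepsilon;k;w\rangle$; $\langle\varepsilon;e::k;w\rangle\to\langle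 e;k;w\rangle$. Heaps: a heap $\pi$ is a finite partial function from addresses to nodes, where there is a distinguished address $\mathrm{null}$ not in the domain of any heap. A node is one of: $a$ ($a\in\Sigma$), $\varepsilon$, $(p_1\mid p_2)$, $(p_1\bullet p_2)$, $(p_1)^{*}$, where $p_1,p_2$ are addresses. For partial functions $f_1,f_2$ with disjoint domains, $f_1\otimes f_2=f_1\cup f_2$ (undefined otherwise). The relation $\pi,p\models e$ is defined by induction on $e$: $\pi,p\models a$ iff $\pi(p)=a$ (and similarly for $\varepsilon$; in these base cases $\pi$ is the single-cell heap mapping $p$ to that node); $\pi,p\models(e_1\mid e_2)$ iff $\pi=\pi_0\otimes\pi_1\otimes\pi_2$ with $\pi_0(p)=(p_1\mid p_2)$, $\pi_1,p_1\models e_1$, $\pi_2,p_2\models e_2$; $\pi,p\models(e_1e_2)$ iff $\pi=\pi_0\otimes\pi_1\otimes\pi_2$ with $\pi_0(p)=(p_1\bullet p_2)$, $\pi_1,p_1\models e_1$, $\pi_2,p_2\models e_2$; $\pi,p\models e_1^{*}$ iff $\pi=\pi_0\otimes\pi_1$ with $\pi_0(p)=(p_1)^{*}$ and $\pi_1,p_1\models e_1$. (Thus $\pi$ lays out the syntax tree of $e$ with root $p$.) Continuation function: $\mathrm{cont}:\mathrm{dom}(\pi)\to\mathrm{dom}(\pi)\cup\{\mathrm{null}\}$ satisfies $\pi\models\mathrm{cont}$ if: whenever $\pi(q)=(q_1\mid q_2)$ then $\mathrm{cont}(q_1)=\mathrm{cont}(q_2)=\mathrm{cont}(q)$; whenever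 $\pi(q)=(q_1\bullet q_2)$ then $\mathrm{cont}(q_1)=q_2$ and $\mathrm{cont}(q_2)=\mathrm{cont}(q)$; whenever $\pi(q)=(q_1)^{*}$ then $\mathrm{cont}(q_1)=q$; and $\mathrm{cont}(p_0)=\mathrm{null}$ for the root $p_0$ of the tree. Such $\mathrm{cont}$ is uniquely determined by $\pi$ and the root. Pointer steps relative to $\pi$: $q\to q_1$ and $q\to q_2$ if $\pi(q)=q_1\mid q_2$; $q\to q_1$ if $\pi(q)=q_1\bullet q_2$; $q\to q_1$ and $q\to\mathrm{cont}(q)$ if $\pi(q)=(q_1)^{*}$; $q\to\mathrm{cont}(q)$ if $\pi(q)=\varepsilon$; and $q\xrightarrow{a}\mathrm{cont}(q)$ if $\pi(q)=a$. The PW$\pi$ machine has configurations $\langle q;w\rangle$ with $q$ an address (possibly $\mathrm{null}$) and $w$ a string, and transitions $\langle q;a\,w\rangle\to\langle q';w\rangle$ whenever $q\xrightarrow{a}q'$, and $\langle q;w\rangle\to\langle q';w\rangle$ whenever $q\to q'$. The address $\mathrm{null}$ has no outgoing steps. -}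

module Defs where

open import Data.Nat using (ℕ; _≤_; _≟_)
open import Relation.Nullary using (yes; no)
open import Data.Fin using (Fin)
open import Data.List using (List; []; _∷_)
open import Data.Maybe using (Maybe; just; nothing)
open import Data.Product using (_×_; ∃; ∃-syntax; _,_)
open import Data.Sum using (_⊎_)
open import Relation.Binary.PropositionalEquality using (_≡_)
open import Function.Bundles using (_↔_)
open import Level using (0ℓ)

Finite : Set → Set
Finite Σ = ∃[ n ] (Σ ↔ Fin n)

module _ (Σ : Set) where

  data RE : Set where
    ε    : RE
    chr  : Σ → RE
    _*   : RE → RE
    _·_  : RE → RE → RE
    _∣_  : RE → RE → RE

  record Conf : Set where
    constructor ⟨_,_,_⟩
    field
      exp  : RE
      cstk : List RE
      str  : List Σ

  data _⟶_ : Conf → Conf → Set where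
    alt₁ : ∀ {e₁ e₂ k w} → ⟨ e₁ ∣ e₂ , k , w ⟩ ⟶ ⟨ e₁ , k , w ⟩
    alt₂ : ∀ {e₁ e₂ k w} → ⟨ e₁ ∣ e₂ , k , w ⟩ ⟶ ⟨ e₂ , k , w ⟩
    seq  : ∀ {e₁ e₂ k w} → ⟨ e₁ · e₂ , k , w ⟩ ⟶ ⟨ e₁ , e₂ ∷ k , w ⟩
    star₁ : ∀ {e k w} → ⟨ e * , k , w ⟩ ⟶ ⟨ e , (e *) ∷ k , w ⟩
    star₂ : ∀ {e k w} → ⟨ e * , k , w ⟩ ⟶ ⟨ ε , k , w ⟩
    match : ∀ {a k w} → ⟨ chr a , k , a ∷ w ⟩ ⟶ ⟨ ε , k , w ⟩
    pop   : ∀ {e k w} → ⟨ ε , e ∷ k , w ⟩ ⟶ ⟨ e , k , w ⟩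

  data _⟶*_ : Conf → Conf → Set where
    done : ∀ {c} → c ⟶* c
    step : ∀ {c₁ c₂ c₃} → c₁ ⟶ c₂ → c₂ ⟶* c₃ → c₁ ⟶* c₃

  -- Heaps.  Addresses are natural numbers; a pointer is either an
  -- address (just q) or the distinguished null (nothing), which is
  -- never in the domain of a heap.
  Addr : Set
  Addr = ℕ

  Ptr : Set
  Ptr = Maybe Addr

  null : Ptr
  null = nothing

  data Node : Set where
    chrN : Σ → Node
    epsN : Node
    altN : Addr → Addr → Node
    seqN : Addr → Addr → Node
    starN : Addr → Node

  Heap : Set
  Heap = Addr → Maybe Node

  FiniteDom : Heap → Set
  FiniteDom π = ∃[ b ] (∀ q → b ≤ q → π q ≡ nothing)

  _≈_⊗_ : Heap → Heap → Heap → Set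
  π ≈ π₁ ⊗ π₂ = ∀ q → (π q ≡ π₁ q × π₂ q ≡ nothing) ⊎ (π q ≡ π₂ q × π₁ q ≡ nothing)

  cell : Addr → Node → Heap
  cell p n q with p ≟ q
  ... | yes _ = just n
  ... | no  _ = nothing

  data _,_⊨_ : Heap → Addr → RE → Set where
    ⊨chr : ∀ {π p a} → (∀ q → π q ≡ cell p (chrN a) q) → π , p ⊨ chr a
    ⊨eps : ∀ {π p} → (∀ q → π q ≡ cell p epsN q) → π , p ⊨ ε
    ⊨alt : ∀ {π π₁₂ π₁ π₂ p p₁ p₂ e₁ e₂} →
           π ≈ cell p (altN p₁ p₂) ⊗ π₁₂ → π₁₂ ≈ π₁ ⊗ π₂ →
           π₁ , p₁ ⊨ e₁ → π₂ , p₂ ⊨ e₂ → π , p ⊨ (e₁ ∣ e₂)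
    ⊨seq : ∀ {π π₁₂ π₁ π₂ p p₁ p₂ e₁ e₂} →
           π ≈ cell p (seqN p₁ p₂) ⊗ π₁₂ → π₁₂ ≈ π₁ ⊗ π₂ →
           π₁ , p₁ ⊨ e₁ → π₂ , p₂ ⊨ e₂ → π , p ⊨ (e₁ · e₂)
    ⊨star : ∀ {π π₁ p p₁ e₁} →
           π ≈ cell p (starN p₁) ⊗ π₁ →
           π₁ , p₁ ⊨ e₁ → π , p ⊨ (e₁ *)

  record ContOK (π : Heap) (p₀ : Addr) (cont : Addr → Ptr) : Set where
    field
      c-alt  : ∀ {q q₁ q₂} → π q ≡ just (altN q₁ q₂) →
               cont q₁ ≡ cont q × cont q₂ ≡ cont q
      c-seq  : ∀ {q q₁ q₂} → π q ≡ just (seqN q₁ q₂) →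
               cont q₁ ≡ just q₂ × cont q₂ ≡ cont q
      c-star : ∀ {q q₁} → π q ≡ just (starN q₁) → cont q₁ ≡ just q
      c-root : cont p₀ ≡ null

  module PW (π : Heap) (cont : Addr → Ptr) where

    data _↦_ : Ptr → Ptr → Set where
      altL  : ∀ {q q₁ q₂} → π q ≡ just (altN q₁ q₂) → just q ↦ just q₁
      altR  : ∀ {q q₁ q₂} → π q ≡ just (altN q₁ q₂) → just q ↦ just q₂
      seqS  : ∀ {q q₁ q₂} → π q ≡ just (seqN q₁ q₂) → just q ↦ just q₁
      starB : ∀ {q q₁} → π q ≡ just (starN q₁) → just q ↦ just q₁
      starE : ∀ {q q₁} → π q ≡ just (starN q₁) → just q ↦ cont q
      epsS  : ∀ {q} → π q ≡ just epsN → just q ↦ cont q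

    data _-_↦_ : Ptr → Σ → Ptr → Set where
      chrS : ∀ {q a} → π q ≡ just (chrN a) → just q - a ↦ cont q

    data _⇒_ : Ptr × List Σ → Ptr × List Σ → Set where
      lab : ∀ {q q' a w} → q - a ↦ q' → (q , a ∷ w) ⇒ (q' , w)
      unl : ∀ {q q' w} → q ↦ q' → (q , w) ⇒ (q' , w)

    data _⇒*_ : Ptr × List Σ → Ptr × List Σ → Set where
      done : ∀ {c} → c ⇒* c
      step : ∀ {c₁ c₂ c₃} → c₁ ⇒ c₂ → c₂ ⇒* c₃ → c₁ ⇒* c₃

-- Idea: an EKW configuration ⟨e ; k ; w⟩ corresponds to a PWπ pointer r
-- when either r points at a copy of the syntax tree of e whose
-- continuation chain spells out the stack k, or e = ε and r itself
-- begins such a chain for k.  The continuation laws make every EKW step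
-- a PWπ step preserving this correspondence (forward simulation), and
-- conversely every PWπ step from the root of a laid-out tree is one of
-- seven moves determined by its node, each mirrored by an EKW step
-- (backward simulation, with the pop rule mirrored by walking the chain).

module Submission where

open import Defs
open import Data.List using (List; []; _∷_)
open import Data.Maybe using (just)
open import Data.Maybe.Properties using (just-injective)
open import Data.Product using (_,_; _×_; Σ-syntax; proj₁; proj₂)
open import Data.Sum using (inj₁; inj₂)
open import Data.Empty using (⊥-elim)
open import Data.Nat using (_≟_)
open import Relation.Nullary using (yes; no)
open import Relation.Binary.PropositionalEquality using (_≡_; refl; sym; trans; subst)
open import Function.Bundles using (_⇔_; mk⇔)

cell-self : ∀ {S} p (n : Node S) → cell S p n p ≡ just n
cell-self p n with p ≟ p
... | yes _ = refl
... | no p≢p = ⊥-elim (p≢p refl)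

⊗-left : ∀ {S} {π π₁ π₂ : Heap S} {q n} →
         _≈_⊗_ S π π₁ π₂ → π₁ q ≡ just n → π q ≡ just n
⊗-left {q = q} split π₁q with split q
... | inj₁ (πq≡π₁q , _) = trans πq≡π₁q π₁q
... | inj₂ (_ , π₁q≡nothing) with trans (sym π₁q) π₁q≡nothing
... | ()

⊗-right : ∀ {S} {π π₁ π₂ : Heap S} {q n} →
          _≈_⊗_ S π π₁ π₂ → π₂ q ≡ just n → π q ≡ just n
⊗-right {q = q} split π₂q with split q
... | inj₂ (πq≡π₂q , _) = trans πq≡π₂q π₂q
... | inj₁ (_ , π₂q≡nothing) with trans (sym π₂q) π₂q≡nothing
... | ()

-- Throughout, π is a heap and cont a continuation function satisfying
-- the continuation laws (for some root p₀, used only by the theorem).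
module Simulation (S : Set) (π : Heap S) (cont : Addr S → Ptr S)
                  (p₀ : Addr S) (cont-ok : ContOK S π p₀ cont) where
  open ContOK cont-ok
  open PW S π cont

  -- Laid q e: the syntax tree of e occurs in π with root q.  Unlike
  -- π , q ⊨ e it says nothing about the rest of π, so it survives
  -- passing from a subheap to the whole heap.
  data Laid : Addr S → RE S → Set where
    laid-chr  : ∀ {q a} → π q ≡ just (chrN a) → Laid q (chr a)
    laid-eps  : ∀ {q} → π q ≡ just epsN → Laid q ε
    laid-alt  : ∀ {q q₁ q₂ e₁ e₂} → π q ≡ just (altN q₁ q₂) →
                Laid q₁ e₁ → Laid q₂ e₂ → Laid q (e₁ ∣ e₂)
    laid-seq  : ∀ {q q₁ q₂ e₁ e₂} → π q ≡ just (seqN q₁ q₂) →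
                Laid q₁ e₁ → Laid q₂ e₂ → Laid q (e₁ · e₂)
    laid-star : ∀ {q q₁ e} → π q ≡ just (starN q₁) →
                Laid q₁ e → Laid q (e *)

  laid-from-⊨ : ∀ {π′ q e} → _,_⊨_ S π′ q e →
                (∀ {r n} → π′ r ≡ just n → π r ≡ just n) → Laid q e
  laid-from-⊨ {q = q} (⊨chr is-cell) ⊆π = laid-chr (⊆π (trans (is-cell q) (cell-self q _)))
  laid-from-⊨ {q = q} (⊨eps is-cell) ⊆π = laid-eps (⊆π (trans (is-cell q) (cell-self q _)))
  laid-from-⊨ {q = q} (⊨alt root rest ⊨₁ ⊨₂) ⊆π =
    laid-alt (⊆π (⊗-left root (cell-self q _)))
             (laid-from-⊨ ⊨₁ λ r → ⊆π (⊗-right root (⊗-left rest r)))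
             (laid-from-⊨ ⊨₂ λ r → ⊆π (⊗-right root (⊗-right rest r)))
  laid-from-⊨ {q = q} (⊨seq root rest ⊨₁ ⊨₂) ⊆π =
    laid-seq (⊆π (⊗-left root (cell-self q _)))
             (laid-from-⊨ ⊨₁ λ r → ⊆π (⊗-right root (⊗-left rest r)))
             (laid-from-⊨ ⊨₂ λ r → ⊆π (⊗-right root (⊗-right rest r)))
  laid-from-⊨ {q = q} (⊨star root ⊨₁) ⊆π =
    laid-star (⊆π (⊗-left root (cell-self q _)))
              (laid-from-⊨ ⊨₁ λ r → ⊆π (⊗-right root r))

  Stack : Ptr S → List (RE S) → Set
  Stack r []      = r ≡ null S
  Stack r (e ∷ k) = Σ[ q ∈ Addr S ] (r ≡ just q × Laid q e × Stack (cont q) k)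

  stack-cong : ∀ {r r′ k} → r ≡ r′ → Stack r′ k → Stack r k
  stack-cong {k = k} r≡r′ = subst (λ x → Stack x k) (sym r≡r′)

  data Sim : RE S → List (RE S) → Ptr S → Set where
    at-tree : ∀ {q e k} → Laid q e → Stack (cont q) k → Sim e k (just q)
    at-cont : ∀ {r k} → Stack r k → Sim ε k r

  pop-stack : ∀ {r e k} → Stack r (e ∷ k) → Sim e k r
  pop-stack (_ , refl , laid , rest) = at-tree laid rest

  push-seq : ∀ {q q₁ q₂ e₂ k} → π q ≡ just (seqN q₁ q₂) → Laid q₂ e₂ →
             Stack (cont q) k → Stack (cont q₁) (e₂ ∷ k)
  push-seq node laid₂ k-stack =
    stack-cong (proj₁ (c-seq node)) (_ , refl , laid₂ , stack-cong (proj₂ (c-seq node)) k-stack)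

  push-star : ∀ {q q₁ e k} → π q ≡ just (starN q₁) → Laid q₁ e →
              Stack (cont q) k → Stack (cont q₁) ((e *) ∷ k)
  push-star node laid k-stack = stack-cong (c-star node) (_ , refl , laid-star node laid , k-stack)

  finished : ∀ {r} → Stack r [] → (r , []) ⇒* (null S , [])
  finished refl = done

  ekw⇒pw : ∀ {e k w r} → _⟶*_ S ⟨ e , k , w ⟩ ⟨ ε , [] , [] ⟩ →
           Sim e k r → (r , w) ⇒* (null S , [])
  ekw⇒pw done (at-tree (laid-eps node) k-stack) = step (unl (epsS node)) (finished k-stack)
  ekw⇒pw done (at-cont k-stack) = finished k-stack
  ekw⇒pw (step alt₁ run) (at-tree (laid-alt node laid₁ _) k-stack) =
    step (unl (altL node)) (ekw⇒pw run (at-tree laid₁ (stack-cong (proj₁ (c-alt node)) k-stack)))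
  ekw⇒pw (step alt₂ run) (at-tree (laid-alt node _ laid₂) k-stack) =
    step (unl (altR node)) (ekw⇒pw run (at-tree laid₂ (stack-cong (proj₂ (c-alt node)) k-stack)))
  ekw⇒pw (step seq run) (at-tree (laid-seq node laid₁ laid₂) k-stack) =
    step (unl (seqS node)) (ekw⇒pw run (at-tree laid₁ (push-seq node laid₂ k-stack)))
  ekw⇒pw (step star₁ run) (at-tree (laid-star node laid) k-stack) =
    step (unl (starB node)) (ekw⇒pw run (at-tree laid (push-star node laid k-stack)))
  ekw⇒pw (step star₂ run) (at-tree (laid-star node _) k-stack) =
    step (unl (starE node)) (ekw⇒pw run (at-cont k-stack))
  ekw⇒pw (step match run) (at-tree (laid-chr node) k-stack) =
    step (lab (chrS node)) (ekw⇒pw run (at-cont k-stack))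
  ekw⇒pw (step pop run) (at-tree (laid-eps node) k-stack) =
    step (unl (epsS node)) (ekw⇒pw run (pop-stack k-stack))
  ekw⇒pw (step pop run) (at-cont k-stack) = ekw⇒pw run (pop-stack k-stack)

  data Move (q : Addr S) : Node S → List S → Ptr S × List S → Set where
    move-chr   : ∀ {a w} → Move q (chrN a) (a ∷ w) (cont q , w)
    move-eps   : ∀ {w} → Move q epsN w (cont q , w)
    move-altL  : ∀ {q₁ q₂ w} → Move q (altN q₁ q₂) w (just q₁ , w)
    move-altR  : ∀ {q₁ q₂ w} → Move q (altN q₁ q₂) w (just q₂ , w)
    move-seq   : ∀ {q₁ q₂ w} → Move q (seqN q₁ q₂) w (just q₁ , w)
    move-enter : ∀ {q₁ w} → Move q (starN q₁) w (just q₁ , w)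
    move-exit  : ∀ {q₁ w} → Move q (starN q₁) w (cont q , w)

  moves : ∀ {q n w c} → π q ≡ just n → (just q , w) ⇒ c → Move q n w c
  moves node (lab (chrS node′)) with just-injective (trans (sym node) node′)
  ... | refl = move-chr
  moves node (unl (epsS node′)) with just-injective (trans (sym node) node′)
  ... | refl = move-eps
  moves node (unl (altL node′)) with just-injective (trans (sym node) node′)
  ... | refl = move-altL
  moves node (unl (altR node′)) with just-injective (trans (sym node) node′)
  ... | refl = move-altR
  moves node (unl (seqS node′)) with just-injective (trans (sym node) node′)
  ... | refl = move-seq
  moves node (unl (starB node′)) with just-injective (trans (sym node) node′)
  ... | refl = move-enter
  moves node (unl (starE node′)) with just-injective (trans (sym node) node′)
  ... | refl = move-exit

  mutual
    pw⇒ekw-cont : ∀ {r k w} → (r , w) ⇒* (null S , []) → Stack r k →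
                  _⟶*_ S ⟨ ε , k , w ⟩ ⟨ ε , [] , [] ⟩
    pw⇒ekw-cont {k = []} done refl = done
    pw⇒ekw-cont {k = []} (step (lab ()) _) refl
    pw⇒ekw-cont {k = []} (step (unl ()) _) refl
    pw⇒ekw-cont {k = _ ∷ _} run (_ , refl , laid , k-stack) = step pop (pw⇒ekw-tree run laid k-stack)

    pw⇒ekw-tree : ∀ {q e k w} → (just q , w) ⇒* (null S , []) → Laid q e →
                  Stack (cont q) k → _⟶*_ S ⟨ e , k , w ⟩ ⟨ ε , [] , [] ⟩
    pw⇒ekw-tree (step s run) (laid-chr node) k-stack with moves node s
    ... | move-chr = step match (pw⇒ekw-cont run k-stack)
    pw⇒ekw-tree (step s run) (laid-eps node) k-stack with moves node s
    ... | move-eps = pw⇒ekw-cont run k-stack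
    pw⇒ekw-tree (step s run) (laid-alt node laid₁ laid₂) k-stack with moves node s
    ... | move-altL = step alt₁ (pw⇒ekw-tree run laid₁ (stack-cong (proj₁ (c-alt node)) k-stack))
    ... | move-altR = step alt₂ (pw⇒ekw-tree run laid₂ (stack-cong (proj₂ (c-alt node)) k-stack))
    pw⇒ekw-tree (step s run) (laid-seq node laid₁ laid₂) k-stack with moves node s
    ... | move-seq = step seq (pw⇒ekw-tree run laid₁ (push-seq node laid₂ k-stack))
    pw⇒ekw-tree (step s run) (laid-star node laid) k-stack with moves node s
    ... | move-enter = step star₁ (pw⇒ekw-tree run laid (push-star node laid k-stack))
    ... | move-exit  = step star₂ (pw⇒ekw-cont run k-stack)

theorem2 : (Σ : Set) → Finite Σ → (e : RE Σ) (π : Heap Σ) (p : Addr Σ) →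
    FiniteDom Σ π → _,_⊨_ Σ π p e →
    (cont : Addr Σ → Ptr Σ) → ContOK Σ π p cont →
    (w : List Σ) →
    (_⟶*_ Σ ⟨ e , [] , w ⟩ ⟨ ε , [] , [] ⟩) ⇔
    (PW._⇒*_ Σ π cont (just p , w) (null Σ , []))
theorem2 Σ _ e π p _ p⊨e cont cont-ok w =
  mk⇔ (λ run → ekw⇒pw run (at-tree laid (ContOK.c-root cont-ok)))
      (λ run → pw⇒ekw-tree run laid (ContOK.c-root cont-ok))
  where
    open Simulation Σ π cont p cont-ok

    laid : Laid p e
    laid = laid-from-⊨ p⊨e (λ πp → πp)
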